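{- Let $A_1=(\mathcal{S}_1,\mathcal{E},\mathcal{I}_1,\mathcal{F}_1,\to_1)$ and $A_2=(\mathcal{S}_2,\mathcal{E},\mathcal{I}_2,\mathcal{F}_2,\to_2)$ be Büchi automata over the same set of events. Define the right-biased simulation $$\texttt{fsim}_\texttt{rb}\triangleq\nu X.\ \mu Y.\ \{(s_1,s_2)\mid s_2\in\mathcal{F}_2\wedge\forall e.\forall s_1\xrightarrow{e}_1 s_1'.\exists s_2\xrightarrow{e}_2 s_2'.\ (s_1',s_2')\in X\}\ \cup\ \{(s_1,s_2)\mid \forall e.\forall s_1\xrightarrow{e}_1 s_1'.\exists s_2\xrightarrow{e}_2 s_2'.\ (s_1',s_2')\in Y\}.$$ Then for all $(s_1,s_2)\in\texttt{fsim}_\texttt{rb}$, $\mathit{Traces}_{A_1}(s_1)\subseteq\mathcal{L}_{A_2}(s_2)$.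
   Context: A Büchi automaton $(\mathcal{S},\mathcal{E},\mathcal{I},\mathcal{F},\to)$ consists of a set of states $\mathcal{S}$ (not necessarily finite), a set of events $\mathcal{E}$, initial states $\mathcal{I}\subseteq\mathcal{S}$, accepting states $\mathcal{F}\subseteq\mathcal{S}$, and a labeled transition relation $\to\subseteq\mathcal{S}\times\mathcal{E}\times\mathcal{S}$ (written $s\xrightarrow{e}s'$). $\nu$ and $\mu$ denote greatest and least fixed points of monotone operators on powerset lattices. Traces: $\mathit{Traces}_A\triangleq\nu T.\ \{(s,e\cdot\tau)\mid \exists s\xrightarrow{e}s'.\ (s',\tau)\in T\}\subseteq\mathcal{S}\times\mathcal{E}^\omega$ and $\mathit{Traces}_A(s)\triangleq\{\tau\mid(s,\tau)\in\mathit{Traces}_A\}$ (accepting states are ignored). Language: $\mathcal{L}_A\triangleq\nu L.\ \mu X.\ \{(s,e\cdot\tau)\mid \exists s\xrightarrow{e}s'.\ (s',\tau)\in X\}\cup\{(s,e\cdot\tau)\mid s\in\mathcal{F}\wedge \exists s\xrightarrow{e}s'.\ (s',\tau)\in L\}$ and $\mathcal{L}_A(s)\triangleq\{\tau\mid (s,\tau)\in\mathcal{L}_A\}$. -}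

module Defs where

open import Data.Nat using (ℕ; zero; suc)
open import Data.Product using (Σ; _×_; _,_; ∃-syntax)

record Buchi (E : Set) : Set₁ where
  field
    S     : Set
    I     : S → Set
    F     : S → Set
    _—_⟶_ : S → E → S → Set
open Buchi public

Word : Set → Set
Word E = ℕ → E

hd : ∀ {E} → Word E → E
hd τ = τ zero

tl : ∀ {E} → Word E → Word E
tl τ i = τ (suc i)

-- Greatest fixed point of an operator on the powerset lattice of A
-- (Knaster–Tarski: union of all post-fixed points).
ν : {A : Set} → ((A → Set) → (A → Set)) → A → Set₁
ν {A} Φ a = Σ (A → Set) λ P → (∀ x → P x → Φ P x) × P a

module _ {E : Set} (A : Buchi E) where

  TraceStep : (S A × Word E → Set) → (S A × Word E → Set)
  TraceStep T (s , τ) = ∃[ s' ] ((_—_⟶_ A s (hd τ) s') × T (s' , tl τ))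

  TracesRel : S A × Word E → Set₁
  TracesRel = ν TraceStep

  Traces : S A → Word E → Set₁
  Traces s τ = TracesRel (s , τ)

-- Language:  ν L. μ X. {(s,e·τ) | ∃ s-e→s'. (s',τ) ∈ X}
--                    ∪ {(s,e·τ) | s ∈ F ∧ ∃ s-e→s'. (s',τ) ∈ L}
-- The inner least fixed point is an inductive family.
module _ {E : Set} (A : Buchi E) where

  data LangInner (L : S A × Word E → Set) : S A × Word E → Set where
    step : ∀ {s τ} s' → _—_⟶_ A s (hd τ) s' → LangInner L (s' , tl τ)
         → LangInner L (s , τ)
    acc  : ∀ {s τ} → F A s → (s' : S A) → _—_⟶_ A s (hd τ) s' → L (s' , tl τ)
         → LangInner L (s , τ)

  LangRel : S A × Word E → Set₁
  LangRel = ν LangInner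

  Lang : S A → Word E → Set₁
  Lang s τ = LangRel (s , τ)

module _ {E : Set} (A₁ A₂ : Buchi E) where

  data FsimInner (X : S A₁ × S A₂ → Set) : S A₁ × S A₂ → Set where
    acc  : ∀ {s₁ s₂} → F A₂ s₂
         → (∀ e s₁' → _—_⟶_ A₁ s₁ e s₁' → ∃[ s₂' ] (_—_⟶_ A₂ s₂ e s₂' × X (s₁' , s₂')))
         → FsimInner X (s₁ , s₂)
    step : ∀ {s₁ s₂}
         → (∀ e s₁' → _—_⟶_ A₁ s₁ e s₁' → ∃[ s₂' ] (_—_⟶_ A₂ s₂ e s₂' × FsimInner X (s₁' , s₂')))
         → FsimInner X (s₁ , s₂)

  fsim-rb : S A₁ × S A₂ → Set₁
  fsim-rb = ν FsimInner

-- The witness for the outer greatest fixed point of the language is the relation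
-- pairing (s₂, τ) with some s₁ that s₂ simulates (in a post-fixed point X of
-- fsim-rb) and that has trace τ. Induction on the inner least fixed point of the
-- simulation builds the inner least fixed point of the language step by step: the
-- simulation's step moves become language step moves, and its accepting moves, where
-- s₂ ∈ F₂ and the successor pair lands back in X, become accepting moves.
{-# OPTIONS --safe #-}
module Submission where

open import Defs
open import Data.Product using (_×_; _,_; ∃-syntax)

PostFixed : {A : Set} → ((A → Set) → (A → Set)) → (A → Set) → Set
PostFixed Φ P = ∀ x → P x → Φ P x

module _ {E : Set} (A₁ A₂ : Buchi E) where

  Matched : (S A₁ × S A₂ → Set) → (S A₁ × Word E → Set) → S A₂ × Word E → Set
  Matched X T (s₂ , τ) = ∃[ s₁ ] (X (s₁ , s₂) × T (s₁ , τ))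

  fsimInner⇒langInner : ∀ {X T} → PostFixed (TraceStep A₁) T →
                        ∀ {s₁ s₂} τ → FsimInner A₁ A₂ X (s₁ , s₂) → T (s₁ , τ) →
                        LangInner A₂ (Matched X T) (s₂ , τ)
  fsimInner⇒langInner T-post τ (acc s₂∈F sim) t =
    let s₁′ , s₁⟶s₁′ , t′ = T-post _ t
        s₂′ , s₂⟶s₂′ , x′ = sim (hd τ) s₁′ s₁⟶s₁′
    in acc s₂∈F s₂′ s₂⟶s₂′ (s₁′ , x′ , t′)
  fsimInner⇒langInner T-post τ (step sim) t =
    let s₁′ , s₁⟶s₁′ , t′ = T-post _ t
        s₂′ , s₂⟶s₂′ , y′ = sim (hd τ) s₁′ s₁⟶s₁′
    in step s₂′ s₂⟶s₂′ (fsimInner⇒langInner T-post (tl τ) y′ t′)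

  matched-postFixed : ∀ {X T} → PostFixed (FsimInner A₁ A₂) X → PostFixed (TraceStep A₁) T →
                      PostFixed (LangInner A₂) (Matched X T)
  matched-postFixed X-post T-post (s₂ , τ) (s₁ , x , t) =
    fsimInner⇒langInner T-post τ (X-post (s₁ , s₂) x) t

theorem4p10 : {E : Set} (A₁ A₂ : Buchi E) (s₁ : S A₁) (s₂ : S A₂)
    → fsim-rb A₁ A₂ (s₁ , s₂)
    → (τ : Word E) → Traces A₁ s₁ τ → Lang A₂ s₂ τ
theorem4p10 A₁ A₂ s₁ s₂ (X , X-post , x) τ (T , T-post , t) =
  Matched A₁ A₂ X T , matched-postFixed A₁ A₂ X-post T-post , (s₁ , x , t)
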